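{- If $G$ is a graph and $v\in V(G)$, then $\gamma_g^t(G)\leq \gamma_g^t(G-v)+4$.
   Context: Graphs are finite and simple. Total domination game on a graph $G$: Dominator and Staller alternately choose vertices; a vertex is totally dominated once one of its neighbors has been chosen; a vertex may be chosen only if it has at least one not yet totally dominated neighbor; the game ends when no legal move remains; Dominator aims to minimize and Staller to maximize the number of moves. $\gamma_g^t(G)$ is the number of moves under optimal play when Dominator moves first. $G-v$ is the graph obtained by deleting $v$ and its incident edges. -}

module Defs where

open import Data.Nat using (ℕ; zero; suc; _⊓_; _⊔_)
open import Data.Fin using (Fin; punchIn)
open import Data.Bool using (Bool; true; false; not; _∧_; _∨_)
open import Data.List using (List; []; _∷_; allFin; filterᵇ; foldr)
open import Data.Bool.ListAction using (any)
open import Relation.Binary.PropositionalEquality using (_≡_)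

record Graph (n : ℕ) : Set where
  field
    adj    : Fin n → Fin n → Bool
    sym    : ∀ i j → adj i j ≡ adj j i
    irrefl : ∀ i → adj i i ≡ false
open Graph public

_-ᵥ_ : ∀ {n} → Graph (suc n) → Fin (suc n) → Graph n
adj    (G -ᵥ v) i j = adj G (punchIn v i) (punchIn v j)
sym    (G -ᵥ v) i j = sym G (punchIn v i) (punchIn v j)
irrefl (G -ᵥ v) i   = irrefl G (punchIn v i)

module TotalDominationGame {n : ℕ} (G : Graph n) where

  -- A game position is the set D of vertices already totally dominated
  -- (i.e. having a chosen neighbour).
  Position : Set
  Position = Fin n → Bool

  legal : Position → Fin n → Bool
  legal D v = any (λ u → adj G v u ∧ not (D u)) (allFin n)

  play : Position → Fin n → Position
  play D v u = D u ∨ adj G v u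

  -- Number of remaining moves under optimal play from position D.
  -- turn = true: Dominator to move (minimises); false: Staller (maximises).
  -- The fuel argument bounds the recursion; every legal move strictly
  -- enlarges D, so at most n moves are ever made and fuel n is sufficient
  -- (the fuel never runs out before the game ends).
  value : ℕ → Bool → Position → ℕ
  value zero    turn D = 0
  value (suc f) turn D with filterᵇ (legal D) (allFin n)
  ... | []     = 0
  ... | m ∷ ms =
    suc (foldr (λ w acc → pick turn (value f (not turn) (play D w)) acc)
               (value f (not turn) (play D m)) ms)
    where
      pick : Bool → ℕ → ℕ → ℕ
      pick true  a b = a ⊓ b
      pick false a b = a ⊔ b

  γtg : ℕ
  γtg = value n true (λ _ → false)

γ-tg : ∀ {n} → Graph n → ℕ
γ-tg G = TotalDominationGame.γtg G

-- Proof by an imagination strategy.  Dominator plays the real game on G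
-- while imagining an optimally played game on H = G - v, and keeps the
-- invariant D' ⊑ D: every vertex dominated in the imagined position D' is
-- dominated in the real position D.  A real move either copies a legal
-- imagined move, or it "touches" v: it is v itself, or it dominates v for
-- the first time.  Such moves lower the potential
--   potential D = [v not yet dominated] + [v still a legal move] ≤ 2,
-- and a touching move of Staller costs at most one extra move of Dominator.
-- Hence the real value is at most the imagined value plus 2 · potential
-- (lemma imagination-bound), which gives the bound 4 at the start.
module Submission where

open import Defs using (Graph; adj; _-ᵥ_; module TotalDominationGame; γ-tg)
open import Data.Nat using (ℕ; zero; suc; _≤_; _<_; _+_; _*_; _⊓_; _⊔_; z≤n; s≤s)
open import Data.Nat.Properties
  using (≤-refl; ≤-trans; ≤-reflexive; ≤-pred; m⊓n≤m; m⊓n≤n; ⊓-sel; m≤m⊔n; m≤n⊔m; ⊔-lub;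
         +-mono-≤; +-monoʳ-≤; +-mono-≤-<; +-mono-<-≤; +-suc; *-suc; *-monoʳ-≤;
         m≤m+n; m≤n+m; n≮0; module ≤-Reasoning)
open import Data.Fin using (Fin; punchIn; punchOut) renaming (zero to fzero; suc to fsuc)
open import Data.Fin.Properties using (any?; punchIn-punchOut) renaming (_≟_ to _≟ᶠ_)
open import Data.Bool using (Bool; true; false; not; _∧_; T; T?)
open import Data.Bool.Properties using (T-≡; ¬-not; not-¬; ∨-zeroʳ) renaming (_≟_ to _≟ᵇ_)
open import Data.List using (List; []; _∷_; allFin; filterᵇ; foldr)
open import Data.List.Relation.Unary.Any using (here; there; satisfied)
open import Data.List.Relation.Unary.Any.Properties using (any⁺; any⁻)
open import Data.List.Membership.Propositional using (_∈_; lose)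
open import Data.List.Membership.Propositional.Properties using (∈-allFin; ∈-filter⁺; ∈-filter⁻)
open import Data.Product using (∃; _×_; _,_; proj₂)
open import Data.Sum using (_⊎_; inj₁; inj₂)
open import Data.Empty using (⊥; ⊥-elim)
open import Function using (_∘_; Equivalence)
open import Relation.Nullary using (yes; no)
open import Relation.Binary.PropositionalEquality
  using (_≡_; refl; sym; trans; cong; subst; module ≡-Reasoning)

foldr-⊓-≤ : ∀ {A : Set} (a : A → ℕ) {m ms x} → x ∈ m ∷ ms →
  foldr (λ w acc → a w ⊓ acc) (a m) ms ≤ a x
foldr-⊓-≤ a {ms = []}     (here refl)         = ≤-refl
foldr-⊓-≤ a {ms = y ∷ ys} (here refl)         =
  ≤-trans (m⊓n≤n (a y) _) (foldr-⊓-≤ a {ms = ys} (here refl))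
foldr-⊓-≤ a {ms = y ∷ ys} (there (here refl)) = m⊓n≤m (a y) _
foldr-⊓-≤ a {ms = y ∷ ys} (there (there x∈)) =
  ≤-trans (m⊓n≤n (a y) _) (foldr-⊓-≤ a {ms = ys} (there x∈))

foldr-⊓-attained : ∀ {A : Set} (a : A → ℕ) m ms →
  ∃ λ x → x ∈ m ∷ ms × a x ≡ foldr (λ w acc → a w ⊓ acc) (a m) ms
foldr-⊓-attained a m [] = m , here refl , refl
foldr-⊓-attained a m (y ∷ ys) with ⊓-sel (a y) (foldr (λ w acc → a w ⊓ acc) (a m) ys)
... | inj₁ min≡ay = y , there (here refl) , sym min≡ay
... | inj₂ min≡rest with foldr-⊓-attained a m ys
...   | x , here x≡m , ax≡ = x , here x≡m , trans ax≡ (sym min≡rest)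
...   | x , there x∈ , ax≡ = x , there (there x∈) , trans ax≡ (sym min≡rest)

foldr-⊔-≥ : ∀ {A : Set} (a : A → ℕ) {m ms x} → x ∈ m ∷ ms →
  a x ≤ foldr (λ w acc → a w ⊔ acc) (a m) ms
foldr-⊔-≥ a {ms = []}     (here refl)         = ≤-refl
foldr-⊔-≥ a {ms = y ∷ ys} (here refl)         =
  ≤-trans (foldr-⊔-≥ a {ms = ys} (here refl)) (m≤n⊔m (a y) _)
foldr-⊔-≥ a {ms = y ∷ ys} (there (here refl)) = m≤m⊔n (a y) _
foldr-⊔-≥ a {ms = y ∷ ys} (there (there x∈)) =
  ≤-trans (foldr-⊔-≥ a {ms = ys} (there x∈)) (m≤n⊔m (a y) _)

foldr-⊔-lub : ∀ {A : Set} (a : A → ℕ) m ms {c} → (∀ {x} → x ∈ m ∷ ms → a x ≤ c) →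
  foldr (λ w acc → a w ⊔ acc) (a m) ms ≤ c
foldr-⊔-lub a m []       bound = bound (here refl)
foldr-⊔-lub a m (y ∷ ys) bound = ⊔-lub (bound (there (here refl))) (foldr-⊔-lub a m ys bound′)
  where
  bound′ : ∀ {x} → x ∈ m ∷ ys → a x ≤ _
  bound′ (here x≡m) = bound (here x≡m)
  bound′ (there x∈) = bound (there (there x∈))

indicator : Bool → ℕ
indicator true  = 1
indicator false = 0

indicator-mono : ∀ {a b} → (a ≡ true → b ≡ true) → indicator a ≤ indicator b
indicator-mono {false} _    = z≤n
indicator-mono {true}  a⇒b rewrite a⇒b refl = ≤-refl

indicator-antitone : ∀ {a b} → (a ≡ true → b ≡ true) → indicator (not b) ≤ indicator (not a)
indicator-antitone {b = true} _ = z≤n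
indicator-antitone {true} {false} a⇒b with a⇒b refl
... | ()
indicator-antitone {false} {false} _ = ≤-refl

indicator-≤1 : ∀ b → indicator b ≤ 1
indicator-≤1 true  = ≤-refl
indicator-≤1 false = z≤n

_⊆_ : ∀ {m} → (Fin m → Bool) → (Fin m → Bool) → Set
D ⊆ E = ∀ i → D i ≡ true → E i ≡ true

⊆-false : ∀ {m} {D E : Fin m → Bool} → D ⊆ E → ∀ {i} → E i ≡ false → D i ≡ false
⊆-false {D = D} D⊆E {i} Ei≡false with D i in Di
... | false = refl
... | true  = trans (sym (D⊆E i Di)) Ei≡false

-- The number of vertices not yet dominated.  A game from D needs at most
-- this many moves, so it is the fuel sufficient for the value function.
undominated : ∀ {m} → (Fin m → Bool) → ℕ
undominated {zero}  D = 0
undominated {suc m} D = indicator (not (D fzero)) + undominated (D ∘ fsuc)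

undominated-antitone : ∀ {m} {D E : Fin m → Bool} → D ⊆ E → undominated E ≤ undominated D
undominated-antitone {zero}  D⊆E = z≤n
undominated-antitone {suc m} D⊆E =
  +-mono-≤ (indicator-antitone (D⊆E fzero)) (undominated-antitone (D⊆E ∘ fsuc))

undominated-strict : ∀ {m} {D E : Fin m → Bool} → D ⊆ E →
  ∀ i → D i ≡ false → E i ≡ true → undominated E < undominated D
undominated-strict {suc m} {D} {E} D⊆E fzero Di Ei rewrite Di | Ei =
  s≤s (undominated-antitone (D⊆E ∘ fsuc))
undominated-strict {suc m} D⊆E (fsuc i) Di Ei =
  +-mono-≤-< (indicator-antitone (D⊆E fzero)) (undominated-strict (D⊆E ∘ fsuc) i Di Ei)

undominated-none : ∀ m → undominated {m} (λ _ → false) ≡ m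
undominated-none zero    = refl
undominated-none (suc m) = cong suc (undominated-none m)

module GameFacts {k : ℕ} (G : Graph k) where
  open TotalDominationGame G

  legal-witness : ∀ {D x} → legal D x ≡ true → ∃ λ u → adj G x u ≡ true × D u ≡ false
  legal-witness {D} {x} lx with satisfied (any⁻ _ (allFin k) (Equivalence.from T-≡ lx))
  ... | u , witness with adj G x u in a | D u in d
  ... | true  | false = u , a , d
  ... | true  | true  = ⊥-elim witness
  ... | false | _     = ⊥-elim witness

  legal-intro : ∀ {D x u} → adj G x u ≡ true → D u ≡ false → legal D x ≡ true
  legal-intro {D} {x} {u} a d = Equivalence.to T-≡ (any⁺ _ (lose (∈-allFin u) witness))
    where
    witness : T (adj G x u ∧ not (D u))
    witness rewrite a | d = _

  legal? : ∀ D → (∃ λ x → legal D x ≡ true) ⊎ (∀ x → legal D x ≡ false)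
  legal? D with any? (λ x → legal D x ≟ᵇ true)
  ... | yes found = inj₁ found
  ... | no  none  = inj₂ λ x → ¬-not (λ lx → none (x , lx))

  play-extends : ∀ D x → D ⊆ play D x
  play-extends D x i Di rewrite Di = refl

  play-dominates : ∀ D {x u} → adj G x u ≡ true → play D x u ≡ true
  play-dominates D {x} {u} a rewrite a = ∨-zeroʳ (D u)

  play-least : ∀ {D E x} → D ⊆ E → (∀ u → adj G x u ≡ true → E u ≡ true) → play D x ⊆ E
  play-least {D} D⊆E N⊆E u h with D u in d
  ... | true  = D⊆E u d
  ... | false = N⊆E u h

  play-monotone : ∀ {D E} x → D ⊆ E → play D x ⊆ play E x
  play-monotone {E = E} x D⊆E =
    play-least (λ i Di → play-extends E x i (D⊆E i Di)) (λ u → play-dominates E)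

  illegal-neighbour : ∀ {D x u} → legal D x ≡ false → adj G x u ≡ true → D u ≡ true
  illegal-neighbour {D} {u = u} nx a with D u in d
  ... | true  = refl
  ... | false = trans (sym nx) (legal-intro a d)

  legal-antitone : ∀ {D E x} → D ⊆ E → legal E x ≡ true → legal D x ≡ true
  legal-antitone D⊆E lx with legal-witness lx
  ... | u , a , d = legal-intro a (⊆-false D⊆E d)

  played-illegal : ∀ D x → legal (play D x) x ≡ false
  played-illegal D x with legal (play D x) x in lx
  ... | false = refl
  ... | true with legal-witness lx
  ...   | u , a , d = trans (sym (play-dominates D a)) d

  legal-shrinks : ∀ {D x} → legal D x ≡ true → undominated (play D x) < undominated D
  legal-shrinks {D} {x} lx with legal-witness lx
  ... | u , a , d = undominated-strict (play-extends D x) u d (play-dominates D a)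

  moves : Position → List (Fin k)
  moves D = filterᵇ (legal D) (allFin k)

  ∈-moves⁺ : ∀ {D x} → legal D x ≡ true → x ∈ moves D
  ∈-moves⁺ {D} {x} lx = ∈-filter⁺ (T? ∘ legal D) (∈-allFin x) (Equivalence.from T-≡ lx)

  ∈-moves⁻ : ∀ {D x} → x ∈ moves D → legal D x ≡ true
  ∈-moves⁻ {D} x∈ = Equivalence.to T-≡ (proj₂ (∈-filter⁻ (T? ∘ legal D) {xs = allFin k} x∈))

  no-moves : ∀ {D x} → legal D x ≡ true → moves D ≡ [] → ⊥
  no-moves lx empty with subst (_ ∈_) empty (∈-moves⁺ lx)
  ... | ()

  value-exhausted : ∀ f t {D} → (∀ x → legal D x ≡ false) → value f t D ≡ 0
  value-exhausted zero    t     none = refl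
  value-exhausted (suc f) t {D} none with moves D in eq
  ... | []    = refl
  ... | m ∷ _ = ⊥-elim (not-¬ (∈-moves⁻ (subst (m ∈_) (sym eq) (here refl))) (none m))

  dominator-≤ : ∀ f {D y} → legal D y ≡ true →
    value (suc f) true D ≤ suc (value f false (play D y))
  dominator-≤ f {D} ly with moves D in eq
  ... | []     = ⊥-elim (no-moves ly eq)
  ... | m ∷ ms =
    s≤s (foldr-⊓-≤ (λ w → value f false (play D w)) (subst (_ ∈_) eq (∈-moves⁺ ly)))

  dominator-attains : ∀ f {D} → (∃ λ x → legal D x ≡ true) →
    ∃ λ w → legal D w ≡ true × suc (value f false (play D w)) ≡ value (suc f) true D
  dominator-attains f {D} (x , lx) with moves D in eq
  ... | []     = ⊥-elim (no-moves lx eq)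
  ... | m ∷ ms with foldr-⊓-attained (λ w → value f false (play D w)) m ms
  ...   | w , w∈ , optimal = w , ∈-moves⁻ (subst (w ∈_) (sym eq) w∈) , cong suc optimal

  staller-≥ : ∀ f {D x} → legal D x ≡ true →
    suc (value f true (play D x)) ≤ value (suc f) false D
  staller-≥ f {D} lx with moves D in eq
  ... | []     = ⊥-elim (no-moves lx eq)
  ... | m ∷ ms =
    s≤s (foldr-⊔-≥ (λ w → value f true (play D w)) (subst (_ ∈_) eq (∈-moves⁺ lx)))

  every-move-≤ : ∀ f t {D c} →
    (∀ x → legal D x ≡ true → suc (value f (not t) (play D x)) ≤ c) →
    value (suc f) t D ≤ c
  every-move-≤ f true {D} bound with moves D in eq
  ... | []     = z≤n
  ... | m ∷ ms = ≤-trans (s≤s (foldr-⊓-≤ (λ w → value f false (play D w)) {ms = ms} (here refl)))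
                         (bound m (∈-moves⁻ (subst (m ∈_) (sym eq) (here refl))))
  every-move-≤ f false {D} bound with moves D in eq
  ... | []     = z≤n
  ... | m ∷ ms with bound m (∈-moves⁻ (subst (m ∈_) (sym eq) (here refl)))
  ...   | s≤s _ = s≤s (foldr-⊔-lub (λ w → value f true (play D w)) m ms
                    (λ {x} x∈ → ≤-pred (bound x (∈-moves⁻ (subst (x ∈_) (sym eq) x∈)))))

-- Two extra moves are paid for by one unit of potential, counted twice.
two-moves : ∀ a b → suc (suc (a + 2 * b)) ≡ a + 2 * suc b
two-moves a b = begin
  suc (suc (a + 2 * b))  ≡⟨ cong suc (+-suc a (2 * b)) ⟨
  suc (a + suc (2 * b))  ≡⟨ +-suc a (suc (2 * b)) ⟨
  a + (2 + 2 * b)        ≡⟨ cong (a +_) (*-suc 2 b) ⟨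
  a + 2 * suc b          ∎
  where open ≡-Reasoning

module Imagination {n : ℕ} (G : Graph (suc n)) (v : Fin (suc n)) where
  H : Graph n
  H = G -ᵥ v

  module R = TotalDominationGame G
  module I = TotalDominationGame H
  module FR = GameFacts G
  module FI = GameFacts H

  vertex-cases : ∀ x → v ≡ x ⊎ ∃ λ j → punchIn v j ≡ x
  vertex-cases x with v ≟ᶠ x
  ... | yes v≡x = inj₁ v≡x
  ... | no  v≢x = inj₂ (punchOut v≢x , punchIn-punchOut v≢x)

  _⊑_ : I.Position → R.Position → Set
  D' ⊑ D = D' ⊆ (D ∘ punchIn v)

  ⊑-extend : ∀ {D' D E} → D' ⊑ D → D ⊆ E → D' ⊑ E
  ⊑-extend D'⊑D D⊆E i D'i = D⊆E (punchIn v i) (D'⊑D i D'i)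

  ⊑-copy : ∀ {D' D} j → D' ⊑ D → I.play D' j ⊑ R.play D (punchIn v j)
  ⊑-copy {D = D} j = FI.play-monotone {E = D ∘ punchIn v} j

  -- If the image of j is not legal in G, all neighbours of j are already
  -- dominated in D, so the imagined move j needs no real answer.
  ⊑-absorb : ∀ {D' D j} → D' ⊑ D → R.legal D (punchIn v j) ≡ false → I.play D' j ⊑ D
  ⊑-absorb D'⊑D nj = FI.play-least D'⊑D (λ u → FR.illegal-neighbour nj)

  -- Moves of G that are not copies of moves of H can only concern v:
  -- the potential counts how many such moves may still occur.
  potential : R.Position → ℕ
  potential D = indicator (not (D v)) + indicator (R.legal D v)

  -- At most two such moves: v itself, and the first move dominating v.
  potential-≤2 : ∀ D → potential D ≤ 2
  potential-≤2 D = +-mono-≤ (indicator-≤1 (not (D v))) (indicator-≤1 (R.legal D v))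

  potential-antitone : ∀ {D E} → D ⊆ E → potential E ≤ potential D
  potential-antitone D⊆E =
    +-mono-≤ (indicator-antitone (D⊆E v)) (indicator-mono (FR.legal-antitone D⊆E))

  potential-play : ∀ D x → potential (R.play D x) ≤ potential D
  potential-play D x = potential-antitone (FR.play-extends D x)

  potential-drop-self : ∀ {D} → R.legal D v ≡ true → potential (R.play D v) < potential D
  potential-drop-self {D} lv rewrite FR.played-illegal D v | lv =
    +-mono-≤-< (indicator-antitone (FR.play-extends D v v)) (s≤s z≤n)

  potential-drop-neighbour : ∀ {D x} → adj G x v ≡ true → D v ≡ false →
    potential (R.play D x) < potential D
  potential-drop-neighbour {D} {x} a dv rewrite FR.play-dominates D a | dv =
    +-mono-<-≤ (s≤s z≤n) (indicator-mono (FR.legal-antitone (FR.play-extends D x)))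

  classify : ∀ {D' D x} → D' ⊑ D → R.legal D x ≡ true →
    (∃ λ j → x ≡ punchIn v j × I.legal D' j ≡ true) ⊎ potential (R.play D x) < potential D
  classify {x = x} D'⊑D lx with vertex-cases x
  ... | inj₁ refl = inj₂ (potential-drop-self lx)
  ... | inj₂ (j , refl) with FR.legal-witness lx
  ...   | u , a , du with vertex-cases u
  ...     | inj₁ refl       = inj₂ (potential-drop-neighbour a du)
  ...     | inj₂ (_ , refl) = inj₁ (j , refl , FI.legal-intro a (⊆-false D'⊑D du))

  dominator-response : ∀ {D' D} → D' ⊑ D → ∀ w →
    (∀ x → R.legal D x ≡ false) ⊎ (∃ λ y → R.legal D y ≡ true × I.play D' w ⊑ R.play D y)
  dominator-response {D = D} D'⊑D w with R.legal D (punchIn v w) in lw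
  ... | true  = inj₂ (punchIn v w , lw , ⊑-copy {D = D} w D'⊑D)
  ... | false with FR.legal? D
  ...   | inj₁ (y , ly) = inj₂ (y , ly , ⊑-extend (⊑-absorb D'⊑D lw) (FR.play-extends D y))
  ...   | inj₂ none     = inj₁ none

  -- Once the imagined game is over, every real move lowers the potential.
  finished-bound : ∀ {D'} → (∀ j → I.legal D' j ≡ false) →
    ∀ f t D → D' ⊑ D → R.value f t D ≤ potential D
  finished-bound over zero    t D D'⊑D = z≤n
  finished-bound {D'} over (suc f) t D D'⊑D = FR.every-move-≤ f t bound
    where
    bound : ∀ x → R.legal D x ≡ true → suc (R.value f (not t) (R.play D x)) ≤ potential D
    bound x lx with classify D'⊑D lx
    ... | inj₁ (j , _ , lj) = ⊥-elim (not-¬ lj (over j))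
    ... | inj₂ drop =
      ≤-trans (s≤s (finished-bound over f (not t) (R.play D x) D'⊑Dx)) drop
      where
      D'⊑Dx : D' ⊑ R.play D x
      D'⊑Dx = ⊑-extend D'⊑D (FR.play-extends D x)

  fuel-after : ∀ {D' j g} → I.legal D' j ≡ true → undominated D' ≤ suc g →
    undominated (I.play D' j) ≤ g
  fuel-after lj fuel = ≤-pred (≤-trans (FI.legal-shrinks lj) fuel)

  mutual
    imagination-bound : ∀ f f' t {D' D} → D' ⊑ D → undominated D' ≤ f' →
      R.value f t D ≤ I.value f' t D' + 2 * potential D
    imagination-bound zero    f' t D'⊑D fuel = z≤n
    imagination-bound (suc f) f' t {D'} {D} D'⊑D fuel with FI.legal? D'
    ... | inj₂ over =
      ≤-trans (finished-bound over (suc f) t D D'⊑D)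
              (≤-trans (m≤m+n (potential D) _) (m≤n+m _ (I.value f' t D')))
    ... | inj₁ (j , lj) with f'
    ...   | zero  = ⊥-elim (n≮0 (≤-trans (FI.legal-shrinks lj) fuel))
    ...   | suc g with t
    ...     | true  = dominator-turn f g D'⊑D fuel (j , lj)
    ...     | false = staller-turn f g D'⊑D fuel

    -- Dominator plays an optimal imagined move and answers it in the real game.
    dominator-turn : ∀ f g {D' D} → D' ⊑ D → undominated D' ≤ suc g →
      (∃ λ j → I.legal D' j ≡ true) →
      R.value (suc f) true D ≤ I.value (suc g) true D' + 2 * potential D
    dominator-turn f g {D'} {D} D'⊑D fuel legal-j with FI.dominator-attains g legal-j
    ... | w , lw , optimal with dominator-response D'⊑D w
    ...   | inj₁ over = ≤-trans (≤-reflexive (FR.value-exhausted (suc f) true over)) z≤n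
    ...   | inj₂ (y , ly , D'w⊑Dy) = begin
      R.value (suc f) true D
        ≤⟨ FR.dominator-≤ f ly ⟩
      suc (R.value f false (R.play D y))
        ≤⟨ s≤s (imagination-bound f g false D'w⊑Dy (fuel-after lw fuel)) ⟩
      suc (I.value g false (I.play D' w) + 2 * potential (R.play D y))
        ≤⟨ +-mono-≤ (≤-reflexive optimal) (*-monoʳ-≤ 2 (potential-play D y)) ⟩
      I.value (suc g) true D' + 2 * potential D ∎
      where open ≤-Reasoning

    -- Staller's real move is either copied into the imagined game, or it
    -- lowers the potential and Dominator answers outside the imagined game
    -- (dominator-pass), paying two moves with one unit of potential.
    staller-turn : ∀ f g {D' D} → D' ⊑ D → undominated D' ≤ suc g →
      R.value (suc f) false D ≤ I.value (suc g) false D' + 2 * potential D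
    staller-turn f g {D'} {D} D'⊑D fuel = FR.every-move-≤ f false bound
      where
      K : ℕ
      K = I.value (suc g) false D'
      open ≤-Reasoning
      bound : ∀ x → R.legal D x ≡ true → suc (R.value f true (R.play D x)) ≤ K + 2 * potential D
      bound x lx with classify D'⊑D lx
      ... | inj₁ (j , refl , lj) = begin
        suc (R.value f true (R.play D x))
          ≤⟨ s≤s (imagination-bound f g true (⊑-copy {D = D} j D'⊑D) (fuel-after lj fuel)) ⟩
        suc (I.value g true (I.play D' j) + 2 * potential (R.play D x))
          ≤⟨ +-mono-≤ (FI.staller-≥ g lj) (*-monoʳ-≤ 2 (potential-play D x)) ⟩
        K + 2 * potential D ∎
      ... | inj₂ drop = begin
        suc (R.value f true (R.play D x))
          ≤⟨ s≤s (dominator-pass f (suc g) (⊑-extend D'⊑D (FR.play-extends D x)) fuel) ⟩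
        suc (suc (K + 2 * potential (R.play D x)))
          ≡⟨ two-moves K (potential (R.play D x)) ⟩
        K + 2 * suc (potential (R.play D x))
          ≤⟨ +-monoʳ-≤ K (*-monoʳ-≤ 2 drop) ⟩
        K + 2 * potential D ∎

    -- Dominator, to move in E, stays within one move of the imagined game in
    -- which Staller is to move: he may spend one real move outside it.
    dominator-pass : ∀ f f' {D' E} → D' ⊑ E → undominated D' ≤ f' →
      R.value f true E ≤ suc (I.value f' false D' + 2 * potential E)
    dominator-pass zero    f' D'⊑E fuel = z≤n
    dominator-pass (suc f) f' {D'} {E} D'⊑E fuel = FR.every-move-≤ f true λ y ly →
      s≤s (≤-trans (imagination-bound f f' false (⊑-extend D'⊑E (FR.play-extends E y)) fuel)
                   (+-monoʳ-≤ (I.value f' false D') (*-monoʳ-≤ 2 (potential-play E y))))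

proposition4p1 : ∀ {n} (G : Graph (suc n)) (v : Fin (suc n)) →
    γ-tg G ≤ γ-tg (G -ᵥ v) + 4
proposition4p1 {n} G v = begin
  γ-tg G
    ≤⟨ imagination-bound (suc n) n true nothing-dominated (≤-reflexive (undominated-none n)) ⟩
  γ-tg (G -ᵥ v) + 2 * potential (λ _ → false)
    ≤⟨ +-monoʳ-≤ (γ-tg (G -ᵥ v)) (*-monoʳ-≤ 2 (potential-≤2 (λ _ → false))) ⟩
  γ-tg (G -ᵥ v) + 4 ∎
  where
  open Imagination G v
  open ≤-Reasoning
  nothing-dominated : (λ _ → false) ⊑ (λ _ → false)
  nothing-dominated i ()
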